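{- $\textsc{Bij-Lossy-Code}\cap\textsc{End-Of-Metered-Line}$ can be reduced (by a black-box $\le_{dt}$ reduction) to $\textsc{Binary-Empty-Child-w-Height}$.
   Context: Query model with $\le_{dt}$ reductions (decision-tree reductions with log target-input-length plus depth $\mathrm{polylog}$ in the source size). $\textsc{Bij-Lossy-Code}$: given $f:[N]\to[2N]$, $g:[2N]\to[N]$, find $x\in[2N]$ with $f(g(x))\ne x$, or $y\in[N]$ with $g(f(y))\ne y$. $\textsc{End-Of-Metered-Line}$: given $S,P:[M]\to[M]$, $W:[M]\to[M]\cup\{0\}$, a solution is $1$ if $P(1)\ne1$ or $S(1)=1$ or $W(1)\ne1$; or $x$ with $P(S(x))\ne x$; or $x\ne1$ with $W(x)=1$; or $x$ with ($W(x)>0$ and $W(S(x))-W(x)\ne1$) or ($W(x)>1$ and $W(x)-W(P(x))\ne1$); or $x\ne1$ with $S(P(x))\ne x$. The problem $\textsc{Bij-Lossy-Code}\cap\textsc{End-Of-Metered-Line}$ takes an instance of each and accepts a solution of either. $\textsc{Binary-Empty-Child-w-Height}$: given $V=[K]$, $F,L,R:V\to V$, $H:V\to[K]$, a solution is (s1) $u$ with $F(L(u))\ne u$ or $F(R(u))\ne u$ or $L(u)=R(u)\ne u$; (s2) $1$ if $L(1)=1$ or $R(1)=1$ or $F(1)\ne1$; (s3) $u\in V\setminus\{1\}$ with $u\notin\{L(F(u)),R(F(u))\}$; (s4) $u\ne1$ with $u\ne F(u)$ and $H(u)\ne H(F(u))+1$, or $1$ if $H(1)\ne1$. -}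

module Defs where

open import Data.Nat using (ℕ; zero; suc; _+_; _*_; _^_; _≤_)
open import Data.Nat.Logarithm using (⌈log₂_⌉)
open import Data.Fin using (Fin; toℕ)
import Data.Fin
import Data.Nat
open import Data.Product using (Σ; Σ-syntax; ∃₂; _×_; _,_)
open import Data.Sum using (_⊎_; inj₁; inj₂)
open import Relation.Binary.PropositionalEquality using (_≡_; _≢_)

-- An instance is an oracle  x : (q : Query p) → Ans p q  (a tuple of
-- functions, queried one function value at a time).  'size p' is the
-- input length (number of queryable positions) at parameter p.

record SearchProblem : Set₁ where
  field
    Param : Set
    size  : Param → ℕ
    Query : Param → Set
    Ans   : (p : Param) → Query p → Set
    Sol   : Param → Set
    IsSol : (p : Param) → ((q : Query p) → Ans p q) → Sol p → Set

open SearchProblem public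

data DT (Q : Set) (A : Q → Set) (O : Set) : Set where
  leaf : O → DT Q A O
  node : (q : Q) → (A q → DT Q A O) → DT Q A O

eval : ∀ {Q A O} → DT Q A O → ((q : Q) → A q) → O
eval (leaf o)   x = o
eval (node q k) x = eval (k (x q)) x

data DepthLE {Q A O} : ℕ → DT Q A O → Set where
  leaf≤ : ∀ {d o} → DepthLE d (leaf o)
  node≤ : ∀ {d q k} → (∀ a → DepthLE d (k a)) → DepthLE (suc d) (node q k)

record DTReductionAt (R Q : SearchProblem) (p : Param R) : Set where
  field
    tgt       : Param Q
    depth     : ℕ
    instTree  : (q : Query Q tgt) → DT (Query R p) (Ans R p) (Ans Q tgt q)
    solTree   : Sol Q tgt → DT (Query R p) (Ans R p) (Sol R p)
    instDepth : ∀ q → DepthLE depth (instTree q)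
    solDepth  : ∀ o → DepthLE depth (solTree o)
    correct   : ∀ (x : (q : Query R p) → Ans R p q) (o : Sol Q tgt) →
                IsSol Q tgt (λ q → eval (instTree q) x) o →
                IsSol R p x (eval (solTree o) x)

open DTReductionAt public

-- R ≤dt Q : for every source size there is a decision-tree reduction,
-- and  log(target input length) + depth ≤ polylog(source input length),
-- i.e. ≤ c · ⌈log₂ n⌉^k + c for fixed constants c, k.
_≤dt_ : SearchProblem → SearchProblem → Set
R ≤dt Q =
  Σ[ red ∈ ((p : Param R) → DTReductionAt R Q p) ]
    ∃₂ λ (c k : ℕ) → ∀ (p : Param R) →
      ⌈log₂ size Q (tgt (red p)) ⌉ + depth (red p) ≤ c * ⌈log₂ size R p ⌉ ^ k + c

-- Conventions: [N] = {1,…,N} is represented by Fin N (element i ↦ i+1),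
-- so the distinguished element 1 is Fin.zero.  [M] ∪ {0} is Fin (suc M)
-- with element i ↦ the number i.  Sizes N, M, K are ≥ 1 (written suc n).

data BLCQuery (N : ℕ) : Set where
  qf : Fin N → BLCQuery N
  qg : Fin (2 * N) → BLCQuery N

BLCAns : (N : ℕ) → BLCQuery N → Set
BLCAns N (qf _) = Fin (2 * N)
BLCAns N (qg _) = Fin N

BLCSol : (N : ℕ) → ((q : BLCQuery N) → BLCAns N q) → Fin (2 * N) ⊎ Fin N → Set
BLCSol N I (inj₁ x) = I (qf (I (qg x))) ≢ x
BLCSol N I (inj₂ y) = I (qg (I (qf y))) ≢ y

data EOMLQuery (M : ℕ) : Set where
  qS qP qW : Fin M → EOMLQuery M

EOMLAns : (M : ℕ) → EOMLQuery M → Set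
EOMLAns M (qS _) = Fin M
EOMLAns M (qP _) = Fin M
EOMLAns M (qW _) = Fin (suc M)

module _ {m : ℕ} (I : (q : EOMLQuery (suc m)) → EOMLAns (suc m) q) where
  private
    S P : Fin (suc m) → Fin (suc m)
    S x = I (qS x)
    P x = I (qP x)
    W : Fin (suc m) → ℕ
    W x = toℕ (I (qW x))
    one : Fin (suc m)
    one = Fin.zero

  EOMLSol : Fin (suc m) → Set
  EOMLSol x =
      (x ≡ one × (P one ≢ one ⊎ S one ≡ one ⊎ W one ≢ 1))
    ⊎ P (S x) ≢ x
    ⊎ (x ≢ one × W x ≡ 1)
    ⊎ ((0 Data.Nat.< W x × W (S x) ≢ suc (W x))
       ⊎ (1 Data.Nat.< W x × W x ≢ suc (W (P x))))
    ⊎ (x ≢ one × S (P x) ≢ x)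

BLC∩EOML : SearchProblem
BLC∩EOML = record
  { Param = ℕ × ℕ
  ; size  = λ { (n , m) → 3 * suc n + 3 * suc m }
  ; Query = λ { (n , m) → BLCQuery (suc n) ⊎ EOMLQuery (suc m) }
  ; Ans   = λ { (n , m) (inj₁ q) → BLCAns (suc n) q
              ; (n , m) (inj₂ q) → EOMLAns (suc m) q }
  ; Sol   = λ { (n , m) → (Fin (2 * suc n) ⊎ Fin (suc n)) ⊎ Fin (suc m) }
  ; IsSol = λ { (n , m) I (inj₁ s) → BLCSol (suc n) (λ q → I (inj₁ q)) s
              ; (n , m) I (inj₂ x) → EOMLSol (λ q → I (inj₂ q)) x }
  }

data BECQuery (K : ℕ) : Set where
  qF qL qR qH : Fin K → BECQuery K

module _ {k : ℕ} (I : BECQuery (suc k) → Fin (suc k)) where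
  private
    F L R : Fin (suc k) → Fin (suc k)
    F u = I (qF u)
    L u = I (qL u)
    R u = I (qR u)
    H : Fin (suc k) → ℕ       -- height value in [K] = {1..K}
    H u = suc (toℕ (I (qH u)))
    one : Fin (suc k)
    one = Fin.zero

  BECSol : Fin (suc k) → Set
  BECSol u =
      (F (L u) ≢ u ⊎ F (R u) ≢ u ⊎ (L u ≡ R u × R u ≢ u))
    ⊎ (u ≡ one × (L one ≡ one ⊎ R one ≡ one ⊎ F one ≢ one))
    ⊎ (u ≢ one × u ≢ L (F u) × u ≢ R (F u))
    ⊎ (u ≢ one × u ≢ F u × H u ≢ suc (H (F u)))
    ⊎ (u ≡ one × H one ≢ 1)

Binary-Empty-Child-w-Height : SearchProblem
Binary-Empty-Child-w-Height = record
  { Param = ℕ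
  ; size  = λ k → 4 * suc k
  ; Query = λ k → BECQuery (suc k)
  ; Ans   = λ k _ → Fin (suc k)
  ; Sol   = λ k → Fin (suc k)
  ; IsSol = λ k I u → BECSol I u
  }

module Submission where

-- Vertices of the Binary-Empty-Child instance are pairs (x , t) of a vertex x of the metered
-- line and a tag t ∈ [2N], read as a name y ∈ [N] and a side b ∈ {0, 1}.  A vertex (x , y , b)
-- with W x > 0 has the children (S x , g t , 0) and (S x , g t , 1), the parent (P x , f y) and
-- height W x: f ∘ g = id and g ∘ f = id make parent and child pointers agree, and the meter makes
-- heights grow by one along child edges.  Vertices with W x = 0 are isolated self-loops.  If
-- neither source problem has a solution at the line vertices 1 and x, at the tag t or at the
-- name y, then every condition of Binary-Empty-Child-w-Height holds at (x , t).  Hence a target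
-- solution reveals a source solution among these four candidates, checked with a constant number
-- of queries, and the target size 8MN has logarithm at most twice that of the source size plus 2.

open import Defs
open import Data.Bool using (if_then_else_)
open import Data.Nat using (ℕ; _+_; _*_; _^_; _≤_; _<_; z≤n; s≤s; ⌈_/2⌉; ⌊_/2⌋)
import Data.Nat as ℕ
open import Data.Nat.Properties
  using ( +-comm; +-assoc; +-identityʳ; *-suc; ^-identityʳ; ^-distribˡ-+-*
        ; ≤-trans; m≤m+n; m≤n+m; m≤m*n; m≤n*m; n≢0⇒n>0
        ; +-mono-≤; +-monoˡ-≤; +-monoʳ-≤; *-mono-≤; *-monoˡ-≤; *-monoʳ-≤
        ; ⌊n/2⌋+⌈n/2⌉≡n; ⌊n/2⌋≤⌈n/2⌉; ⌈n/2⌉<n; module ≤-Reasoning )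
open import Data.Nat.Logarithm using (⌈log₂_⌉; ⌈log₂⌉-mono-≤; ⌈log₂2^n⌉≡n)
open import Data.Nat.Logarithm.Core using (⌈log2⌉)
open import Data.Fin using (Fin; zero; suc; toℕ; combine; remQuot; inject≤; _≟_)
open import Data.Fin.Patterns using (0F; 1F)
open import Data.Fin.Properties using (remQuot-combine; combine-remQuot; toℕ-inject≤)
open import Data.Product using (_×_; _,_; proj₁; proj₂; swap; map₂)
open import Data.Sum using (_⊎_; inj₁; inj₂; [_,_])
import Data.Sum
open import Function using (id; _∘_)
open import Function.Definitions using (Injective)
open import Induction.WellFounded using (Acc; acc)
open import Relation.Binary.PropositionalEquality
  using (_≡_; _≢_; refl; sym; trans; cong; cong₂; subst; module ≡-Reasoning)
open import Relation.Nullary using (¬_; Dec; yes; no; does; contradiction)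
open import Relation.Nullary.Decidable using (decidable-stable; _×-dec_; _⊎-dec_; ¬?)

module _ {Q : Set} {A : Q → Set} where

  ask : (q : Q) → DT Q A (A q)
  ask q = node q leaf

  _>>=_ : ∀ {O O′} → DT Q A O → (O → DT Q A O′) → DT Q A O′
  leaf o   >>= k = k o
  node q t >>= k = node q (λ a → t a >>= k)

  DepthLE-weaken : ∀ {O d e} {t : DT Q A O} → d ≤ e → DepthLE d t → DepthLE e t
  DepthLE-weaken _         leaf≤     = leaf≤
  DepthLE-weaken (s≤s d≤e) (node≤ p) = node≤ λ a → DepthLE-weaken d≤e (p a)

  >>=-depth : ∀ {O O′ d e} {t : DT Q A O} {k : O → DT Q A O′} →
              DepthLE d t → (∀ o → DepthLE e (k o)) → DepthLE (d + e) (t >>= k)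
  >>=-depth {d = d} leaf≤     q = DepthLE-weaken (m≤n+m _ d) (q _)
  >>=-depth         (node≤ p) q = node≤ λ a → >>=-depth (p a) q

if-does : ∀ {A T : Set} (Ok : T → Set) (d : Dec A) {a b : T} →
          (A → Ok a) → (¬ A → Ok b) → Ok (if does d then a else b)
if-does Ok (yes p) onYes _    = onYes p
if-does Ok (no ¬p) _    onNo = onNo ¬p

n≤2*⌈n/2⌉ : ∀ n → n ≤ 2 * ⌈ n /2⌉
n≤2*⌈n/2⌉ n = begin
  n                   ≡⟨ ⌊n/2⌋+⌈n/2⌉≡n n ⟨
  ⌊ n /2⌋ + ⌈ n /2⌉   ≤⟨ +-monoˡ-≤ ⌈ n /2⌉ (⌊n/2⌋≤⌈n/2⌉ n) ⟩
  ⌈ n /2⌉ + ⌈ n /2⌉   ≡⟨ cong (⌈ n /2⌉ +_) (+-identityʳ ⌈ n /2⌉) ⟨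
  2 * ⌈ n /2⌉         ∎
  where open ≤-Reasoning

n≤2^⌈log2⌉n : ∀ n (rec : Acc _<_ n) → n ≤ 2 ^ ⌈log2⌉ n rec
n≤2^⌈log2⌉n 0                 _        = z≤n
n≤2^⌈log2⌉n 1                 _        = s≤s z≤n
n≤2^⌈log2⌉n (ℕ.suc (ℕ.suc n)) (acc rs) = begin
  2 + n                 ≤⟨ +-monoʳ-≤ 2 (n≤2*⌈n/2⌉ n) ⟩
  2 + 2 * ⌈ n /2⌉       ≡⟨ *-suc 2 ⌈ n /2⌉ ⟨
  2 * ℕ.suc ⌈ n /2⌉     ≤⟨ *-monoʳ-≤ 2 (n≤2^⌈log2⌉n (ℕ.suc ⌈ n /2⌉) (rs (⌈n/2⌉<n n))) ⟩
  2 * 2 ^ ⌈log2⌉ (ℕ.suc ⌈ n /2⌉) (rs (⌈n/2⌉<n n)) ∎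
  where open ≤-Reasoning

n≤2^⌈log₂n⌉ : ∀ n → n ≤ 2 ^ ⌈log₂ n ⌉
n≤2^⌈log₂n⌉ n = n≤2^⌈log2⌉n n _

⌈log₂m*n⌉≤⌈log₂m⌉+⌈log₂n⌉ : ∀ m n → ⌈log₂ (m * n) ⌉ ≤ ⌈log₂ m ⌉ + ⌈log₂ n ⌉
⌈log₂m*n⌉≤⌈log₂m⌉+⌈log₂n⌉ m n = begin
  ⌈log₂ (m * n) ⌉                         ≤⟨ ⌈log₂⌉-mono-≤ (*-mono-≤ (n≤2^⌈log₂n⌉ m) (n≤2^⌈log₂n⌉ n)) ⟩
  ⌈log₂ (2 ^ ⌈log₂ m ⌉ * 2 ^ ⌈log₂ n ⌉) ⌉ ≡⟨ cong ⌈log₂_⌉ (^-distribˡ-+-* 2 ⌈log₂ m ⌉ ⌈log₂ n ⌉) ⟨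
  ⌈log₂ (2 ^ (⌈log₂ m ⌉ + ⌈log₂ n ⌉)) ⌉   ≡⟨ ⌈log₂2^n⌉≡n _ ⟩
  ⌈log₂ m ⌉ + ⌈log₂ n ⌉                   ∎
  where open ≤-Reasoning

record PointerTree (V : Set) : Set where
  field
    root              : V
    parent left right : V → V
    height            : V → ℕ

module _ {V : Set} (T : PointerTree V) where
  open PointerTree T

  Violation : V → Set
  Violation u =
      (parent (left u) ≢ u ⊎ parent (right u) ≢ u ⊎ (left u ≡ right u × right u ≢ u))
    ⊎ (u ≡ root × (left root ≡ root ⊎ right root ≡ root ⊎ parent root ≢ root))
    ⊎ (u ≢ root × u ≢ left (parent u) × u ≢ right (parent u))
    ⊎ (u ≢ root × u ≢ parent u × height u ≢ ℕ.suc (height (parent u)))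
    ⊎ (u ≡ root × height root ≢ 1)

  record WellFormedRoot : Set where
    field
      left-root≢root  : left root ≢ root
      right-root≢root : right root ≢ root
      parent-root     : parent root ≡ root
      height-root     : height root ≡ 1

  record WellFormedAt (u : V) : Set where
    field
      parent-left     : parent (left u) ≡ u
      parent-right    : parent (right u) ≡ u
      left≡right⇒loop : left u ≡ right u → right u ≡ u
      child-of-parent : u ≡ root ⊎ u ≡ left (parent u) ⊎ u ≡ right (parent u)
      height-step     : u ≡ root ⊎ u ≡ parent u ⊎ height u ≡ ℕ.suc (height (parent u))

  selfLoop⇒wellFormed : ∀ {u} → parent u ≡ u → left u ≡ u → right u ≡ u → WellFormedAt u
  selfLoop⇒wellFormed pu lu ru = record
    { parent-left     = trans (cong parent lu) pu
    ; parent-right    = trans (cong parent ru) pu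
    ; left≡right⇒loop = λ _ → ru
    ; child-of-parent = inj₂ (inj₁ (sym (trans (cong left pu) lu)))
    ; height-step     = inj₂ (inj₁ (sym pu))
    }

  wellFormed⇒¬violation : WellFormedRoot → ∀ {u} → WellFormedAt u → ¬ Violation u
  wellFormed⇒¬violation r w = λ where
      (inj₁ (inj₁ ne))                         → ne parent-left
      (inj₁ (inj₂ (inj₁ ne)))                  → ne parent-right
      (inj₁ (inj₂ (inj₂ (eq , ne))))           → ne (left≡right⇒loop eq)
      (inj₂ (inj₁ (_ , inj₁ eq)))              → left-root≢root eq
      (inj₂ (inj₁ (_ , inj₂ (inj₁ eq))))       → right-root≢root eq
      (inj₂ (inj₁ (_ , inj₂ (inj₂ ne))))       → ne parent-root
      (inj₂ (inj₂ (inj₁ (¬r , ¬l , ¬rr))))     → [ ¬r , [ ¬l , ¬rr ] ] child-of-parent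
      (inj₂ (inj₂ (inj₂ (inj₁ (¬r , ¬p , ¬h))))) → [ ¬r , [ ¬p , ¬h ] ] height-step
      (inj₂ (inj₂ (inj₂ (inj₂ (_ , ne)))))     → ne height-root
    where
      open WellFormedRoot r
      open WellFormedAt w

record Embedding {U V : Set} (T : PointerTree U) (T′ : PointerTree V) : Set where
  private
    module T  = PointerTree T
    module T′ = PointerTree T′
  field
    embed           : U → V
    embed-injective : Injective _≡_ _≡_ embed
    embed-root      : embed T.root ≡ T′.root
    embed-parent    : ∀ u → T′.parent (embed u) ≡ embed (T.parent u)
    embed-left      : ∀ u → T′.left (embed u) ≡ embed (T.left u)
    embed-right     : ∀ u → T′.right (embed u) ≡ embed (T.right u)
    embed-height    : ∀ u → T′.height (embed u) ≡ T.height u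

module _ {U V : Set} {T : PointerTree U} {T′ : PointerTree V} (e : Embedding T T′) where
  open Embedding e
  private
    module T  = PointerTree T
    module T′ = PointerTree T′
  open ≡-Reasoning

  embed-wellFormedRoot : WellFormedRoot T → WellFormedRoot T′
  embed-wellFormedRoot w = record
    { left-root≢root  = λ eq → left-root≢root (embed-injective (begin
        embed (T.left T.root)   ≡⟨ embed-left T.root ⟨
        T′.left (embed T.root)  ≡⟨ cong T′.left embed-root ⟩
        T′.left T′.root         ≡⟨ eq ⟩
        T′.root                 ≡⟨ embed-root ⟨
        embed T.root            ∎))
    ; right-root≢root = λ eq → right-root≢root (embed-injective (begin
        embed (T.right T.root)  ≡⟨ embed-right T.root ⟨
        T′.right (embed T.root) ≡⟨ cong T′.right embed-root ⟩
        T′.right T′.root        ≡⟨ eq ⟩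
        T′.root                 ≡⟨ embed-root ⟨
        embed T.root            ∎))
    ; parent-root     = begin
        T′.parent T′.root        ≡⟨ cong T′.parent embed-root ⟨
        T′.parent (embed T.root) ≡⟨ embed-parent T.root ⟩
        embed (T.parent T.root)  ≡⟨ cong embed parent-root ⟩
        embed T.root             ≡⟨ embed-root ⟩
        T′.root                  ∎
    ; height-root     = begin
        T′.height T′.root        ≡⟨ cong T′.height embed-root ⟨
        T′.height (embed T.root) ≡⟨ embed-height T.root ⟩
        T.height T.root          ≡⟨ height-root ⟩
        1                        ∎
    }
    where open WellFormedRoot w

  embed-wellFormedAt : ∀ {u} → WellFormedAt T u → WellFormedAt T′ (embed u)
  embed-wellFormedAt {u} w = record
    { parent-left     = begin
        T′.parent (T′.left (embed u)) ≡⟨ cong T′.parent (embed-left u) ⟩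
        T′.parent (embed (T.left u))  ≡⟨ embed-parent (T.left u) ⟩
        embed (T.parent (T.left u))   ≡⟨ cong embed parent-left ⟩
        embed u                       ∎
    ; parent-right    = begin
        T′.parent (T′.right (embed u)) ≡⟨ cong T′.parent (embed-right u) ⟩
        T′.parent (embed (T.right u))  ≡⟨ embed-parent (T.right u) ⟩
        embed (T.parent (T.right u))   ≡⟨ cong embed parent-right ⟩
        embed u                        ∎
    ; left≡right⇒loop = λ eq → begin
        T′.right (embed u) ≡⟨ embed-right u ⟩
        embed (T.right u)  ≡⟨ cong embed (left≡right⇒loop (embed-injective (begin
                                embed (T.left u)   ≡⟨ embed-left u ⟨
                                T′.left (embed u)  ≡⟨ eq ⟩
                                T′.right (embed u) ≡⟨ embed-right u ⟩
                                embed (T.right u)  ∎))) ⟩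
        embed u            ∎
    ; child-of-parent = Data.Sum.map embed-≡root
                          (Data.Sum.map (embed-child T′.left T.left embed-left)
                                        (embed-child T′.right T.right embed-right))
                          child-of-parent
    ; height-step     = Data.Sum.map embed-≡root
                          (Data.Sum.map (λ eq → trans (cong embed eq) (sym (embed-parent u))) embed-height-step)
                          height-step
    }
    where
      open WellFormedAt w

      embed-≡root : u ≡ T.root → embed u ≡ T′.root
      embed-≡root eq = trans (cong embed eq) embed-root

      embed-child : (c′ : V → V) (c : U → U) → (∀ v → c′ (embed v) ≡ embed (c v)) →
                    u ≡ c (T.parent u) → embed u ≡ c′ (T′.parent (embed u))
      embed-child c′ c embed-c eq = begin
        embed u                  ≡⟨ cong embed eq ⟩
        embed (c (T.parent u))   ≡⟨ embed-c (T.parent u) ⟨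
        c′ (embed (T.parent u))  ≡⟨ cong c′ (embed-parent u) ⟨
        c′ (T′.parent (embed u)) ∎

      embed-height-step : T.height u ≡ ℕ.suc (T.height (T.parent u)) →
                          T′.height (embed u) ≡ ℕ.suc (T′.height (T′.parent (embed u)))
      embed-height-step eq = begin
        T′.height (embed u)                       ≡⟨ embed-height u ⟩
        T.height u                                ≡⟨ eq ⟩
        ℕ.suc (T.height (T.parent u))             ≡⟨ cong ℕ.suc (embed-height (T.parent u)) ⟨
        ℕ.suc (T′.height (embed (T.parent u)))    ≡⟨ cong (ℕ.suc ∘ T′.height) (embed-parent u) ⟨
        ℕ.suc (T′.height (T′.parent (embed u)))   ∎

oracleTree : ∀ {k} → (BECQuery (ℕ.suc k) → Fin (ℕ.suc k)) → PointerTree (Fin (ℕ.suc k))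
oracleTree I = record
  { root   = zero
  ; parent = λ u → I (qF u)
  ; left   = λ u → I (qL u)
  ; right  = λ u → I (qR u)
  ; height = λ u → ℕ.suc (toℕ (I (qH u)))
  }

record MeteredView (M : ℕ) : Set where
  constructor view
  field
    p₁ s₁           : Fin M
    w₁              : Fin (ℕ.suc M)
    pₓ sₓ p∘sₓ s∘pₓ : Fin M
    wₓ w∘sₓ w∘pₓ    : Fin (ℕ.suc M)

module _ {m : ℕ} (x : Fin (ℕ.suc m)) (v : MeteredView (ℕ.suc m)) where
  open MeteredView v

  MeteredSolution : Set
  MeteredSolution =
      (x ≡ zero × (p₁ ≢ zero ⊎ s₁ ≡ zero ⊎ toℕ w₁ ≢ 1))
    ⊎ p∘sₓ ≢ x
    ⊎ (x ≢ zero × toℕ wₓ ≡ 1)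
    ⊎ ((0 < toℕ wₓ × toℕ w∘sₓ ≢ ℕ.suc (toℕ wₓ))
       ⊎ (1 < toℕ wₓ × toℕ wₓ ≢ ℕ.suc (toℕ w∘pₓ)))
    ⊎ (x ≢ zero × s∘pₓ ≢ x)

  meteredSolution? : Dec MeteredSolution
  meteredSolution? =
          ((x ≟ zero) ×-dec (¬? (p₁ ≟ zero) ⊎-dec (s₁ ≟ zero) ⊎-dec ¬? (toℕ w₁ ℕ.≟ 1)))
    ⊎-dec ¬? (p∘sₓ ≟ x)
    ⊎-dec (¬? (x ≟ zero) ×-dec (toℕ wₓ ℕ.≟ 1))
    ⊎-dec (((0 ℕ.<? toℕ wₓ) ×-dec ¬? (toℕ w∘sₓ ℕ.≟ ℕ.suc (toℕ wₓ)))
           ⊎-dec ((1 ℕ.<? toℕ wₓ) ×-dec ¬? (toℕ wₓ ℕ.≟ ℕ.suc (toℕ w∘pₓ))))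
    ⊎-dec (¬? (x ≟ zero) ×-dec ¬? (s∘pₓ ≟ x))

module MeteredLine {m : ℕ} (J : (q : EOMLQuery (ℕ.suc m)) → EOMLAns (ℕ.suc m) q) where

  S P : Fin (ℕ.suc m) → Fin (ℕ.suc m)
  S x = J (qS x)
  P x = J (qP x)

  W : Fin (ℕ.suc m) → ℕ
  W x = toℕ (J (qW x))

  viewAt : Fin (ℕ.suc m) → MeteredView (ℕ.suc m)
  viewAt x = view (P zero) (S zero) (J (qW zero)) (P x) (S x) (P (S x)) (S (P x))
                  (J (qW x)) (J (qW (S x))) (J (qW (P x)))

  -- EOMLSol J x unfolds to MeteredSolution x (viewAt x), which, unlike EOMLSol, a
  -- decision-tree leaf can evaluate from the ten queried values.
  solution? : ∀ x → Dec (EOMLSol J x)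
  solution? x = meteredSolution? x (viewAt x)

  record SourceFacts : Set where
    field
      P-source : P zero ≡ zero
      S-source : S zero ≢ zero
      W-source : W zero ≡ 1

  record LineFacts (x : Fin (ℕ.suc m)) : Set where
    field
      P∘S : P (S x) ≡ x
      S∘P : x ≢ zero → S (P x) ≡ x
      W≢1 : x ≢ zero → W x ≢ 1
      W∘S : 0 < W x → W (S x) ≡ ℕ.suc (W x)
      W∘P : 1 < W x → W x ≡ ℕ.suc (W (P x))

  ¬solution⇒sourceFacts : ¬ EOMLSol J zero → SourceFacts
  ¬solution⇒sourceFacts ¬sol = record
    { P-source = decidable-stable (P zero ≟ zero) λ ne → ¬sol (inj₁ (refl , inj₁ ne))
    ; S-source = λ eq → ¬sol (inj₁ (refl , inj₂ (inj₁ eq)))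
    ; W-source = decidable-stable (W zero ℕ.≟ 1) λ ne → ¬sol (inj₁ (refl , inj₂ (inj₂ ne)))
    }

  ¬solution⇒lineFacts : ∀ {x} → ¬ EOMLSol J x → LineFacts x
  ¬solution⇒lineFacts {x} ¬sol = record
    { P∘S = decidable-stable (P (S x) ≟ x) λ ne → ¬sol (inj₂ (inj₁ ne))
    ; S∘P = λ x≢0 → decidable-stable (S (P x) ≟ x) λ ne → ¬sol (inj₂ (inj₂ (inj₂ (inj₂ (x≢0 , ne)))))
    ; W≢1 = λ x≢0 eq → ¬sol (inj₂ (inj₂ (inj₁ (x≢0 , eq))))
    ; W∘S = λ 0<w → decidable-stable (W (S x) ℕ.≟ ℕ.suc (W x))
                      λ ne → ¬sol (inj₂ (inj₂ (inj₂ (inj₁ (inj₁ (0<w , ne))))))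
    ; W∘P = λ 1<w → decidable-stable (W x ℕ.≟ ℕ.suc (W (P x)))
                      λ ne → ¬sol (inj₂ (inj₂ (inj₂ (inj₁ (inj₂ (1<w , ne))))))
    }

  S≢zero : SourceFacts → ∀ {x} → LineFacts x → S x ≢ zero
  S≢zero src {x} line Sx≡0 = S-source (subst (λ y → S y ≡ zero) x≡0 Sx≡0)
    where
      open SourceFacts src
      open LineFacts line
      x≡0 : x ≡ zero
      x≡0 = trans (sym P∘S) (trans (cong P Sx≡0) P-source)

  module _ {x : Fin (ℕ.suc m)} (line : LineFacts x) where
    open LineFacts line

    W∘S≢0 : W x ≢ 0 → W (S x) ≢ 0
    W∘S≢0 w≢0 eq with () ← trans (sym (W∘S (n≢0⇒n>0 w≢0))) eq

    W≡suc-W∘P : x ≢ zero → W x ≢ 0 → W x ≡ ℕ.suc (W (P x))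
    W≡suc-W∘P x≢0 w≢0 = W∘P (≢0∧≢1⇒1< (W x) w≢0 (W≢1 x≢0))
      where
        ≢0∧≢1⇒1< : ∀ w → w ≢ 0 → w ≢ 1 → 1 < w
        ≢0∧≢1⇒1< 0                 w≢0 _   = contradiction refl w≢0
        ≢0∧≢1⇒1< 1                 _   w≢1 = contradiction refl w≢1
        ≢0∧≢1⇒1< (ℕ.suc (ℕ.suc _)) _   _   = s≤s (s≤s z≤n)

    W∘P≢0 : x ≢ zero → W x ≢ 0 → W (P x) ≢ 0
    W∘P≢0 x≢0 w≢0 eq = W≢1 x≢0 (trans (W≡suc-W∘P x≢0 w≢0) (cong ℕ.suc eq))

module Construction (n m : ℕ) where

  N M : ℕ
  N = ℕ.suc n
  M = ℕ.suc m

  -- A tag (y , b) stands for combine b y ∈ Fin (2 * N); the name y comes first so that the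
  -- clauses below split on it before the side b.
  Tag : Set
  Tag = Fin N × Fin 2

  Point : Set
  Point = Fin M × Tag

  encodeTag : Tag → Fin (2 * N)
  encodeTag (y , b) = combine b y

  decodeTag : Fin (2 * N) → Tag
  decodeTag z = swap (remQuot N z)

  decodeTag∘encodeTag : ∀ t → decodeTag (encodeTag t) ≡ t
  decodeTag∘encodeTag (y , b) = cong swap (remQuot-combine b y)

  encodeTag∘decodeTag : ∀ z → encodeTag (decodeTag z) ≡ z
  encodeTag∘decodeTag z = combine-remQuot N z

  -- On the source line the root (zero , zero , 0F) has the children (S zero , zero , 0F) and
  -- (S zero , zero , 1F), the vertex (zero , zero , 1F) is isolated, and every other
  -- (zero , t) is a secondary root whose right child is (S zero , t).  So the parent of
  -- (S zero , t) is (zero , collapse t).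
  collapse : Tag → Tag
  collapse (zero , 1F) = (zero , 0F)
  collapse t           = t

  -- What the pointers at (x , y , b) depend on: W x, P x, S x, f y and g (combine b y); the
  -- instance tree reads exactly these five values.
  record Local : Set where
    constructor local
    field
      weight    : Fin (ℕ.suc M)
      pred succ : Fin M
      f-of-name : Fin (2 * N)
      g-of-tag  : Fin N

  parentAt : Point → Local → Point
  parentAt (zero  , t) _                              = (zero , t)
  parentAt (suc x , t) (local zero    _       _ _  _) = (suc x , t)
  parentAt (suc x , t) (local (suc _) zero    _ _  _) = (zero , collapse t)
  parentAt (suc x , t) (local (suc _) (suc p) _ fy _) = (suc p , decodeTag fy)

  leftAt : Point → Local → Point
  leftAt (zero  , zero , 0F) ℓ                  = (Local.succ ℓ , zero , 0F)
  leftAt (zero  , t)         _                  = (zero , t)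
  leftAt (suc x , t) (local zero    _ _ _ _)    = (suc x , t)
  leftAt (suc x , t) (local (suc _) _ s _ gt)   = (s , gt , 0F)

  rightAt : Point → Local → Point
  rightAt (zero  , zero , 0F) ℓ                 = (Local.succ ℓ , zero , 1F)
  rightAt (zero  , zero , 1F) _                 = (zero , zero , 1F)
  rightAt (zero  , t)         ℓ                 = (Local.succ ℓ , t)
  rightAt (suc x , t) (local zero    _ _ _ _)   = (suc x , t)
  rightAt (suc x , t) (local (suc _) _ s _ gt)  = (s , gt , 1F)

  -- Heights in [K] are written suc (toℕ i); a vertex of weight w gets height max 1 w.
  level : Fin (ℕ.suc M) → Fin M
  level zero    = zero
  level (suc w) = w

  module _ (J : (q : EOMLQuery M) → EOMLAns M q) (f : Fin N → Fin (2 * N)) (g : Fin (2 * N) → Fin N) where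
    open MeteredLine J

    localAt : Point → Local
    localAt (x , y , b) = local (J (qW x)) (P x) (S x) (f y) (g (encodeTag (y , b)))

    lineHeight : Fin M → ℕ
    lineHeight x = ℕ.suc (toℕ (level (J (qW x))))

    tree : PointerTree Point
    tree = record
      { root   = (zero , zero , 0F)
      ; parent = λ p → parentAt p (localAt p)
      ; left   = λ p → leftAt p (localAt p)
      ; right  = λ p → rightAt p (localAt p)
      ; height = λ p → lineHeight (proj₁ p)
      }

    open PointerTree tree

    dead-selfLoop : ∀ x t → x ≢ zero → W x ≡ 0 →
                    parent (x , t) ≡ (x , t) × left (x , t) ≡ (x , t) × right (x , t) ≡ (x , t)
    dead-selfLoop zero    _ x≢0 _ = contradiction refl x≢0
    dead-selfLoop (suc x) t _   _ with J (qW (suc x))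
    ... | zero = refl , refl , refl

    left-live : ∀ x t → x ≢ zero → W x ≢ 0 → left (x , t) ≡ (S x , g (encodeTag t) , 0F)
    left-live zero    _ x≢0 _   = contradiction refl x≢0
    left-live (suc x) t _   w≢0 with J (qW (suc x))
    ... | zero  = contradiction refl w≢0
    ... | suc _ = refl

    right-live : ∀ x t → x ≢ zero → W x ≢ 0 → right (x , t) ≡ (S x , g (encodeTag t) , 1F)
    right-live zero    _ x≢0 _   = contradiction refl x≢0
    right-live (suc x) t _   w≢0 with J (qW (suc x))
    ... | zero  = contradiction refl w≢0
    ... | suc _ = refl

    parent-live-line : ∀ x t → x ≢ zero → W x ≢ 0 → proj₁ (parent (x , t)) ≡ P x
    parent-live-line zero    _ x≢0 _   = contradiction refl x≢0
    parent-live-line (suc x) t _   w≢0 with J (qW (suc x)) | J (qP (suc x))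
    ... | zero  | _     = contradiction refl w≢0
    ... | suc _ | zero  = refl
    ... | suc _ | suc _ = refl

    parent-first : ∀ x t → x ≢ zero → W x ≢ 0 → P x ≡ zero → parent (x , t) ≡ (zero , collapse t)
    parent-first zero    _ x≢0 _   _   = contradiction refl x≢0
    parent-first (suc x) t _   w≢0 p≡0 with J (qW (suc x)) | J (qP (suc x))
    ... | zero  | _     = contradiction refl w≢0
    ... | suc _ | zero  = refl
    ... | suc _ | suc _ = contradiction p≡0 λ ()

    parent-later : ∀ x t → x ≢ zero → W x ≢ 0 → P x ≢ zero →
                   parent (x , t) ≡ (P x , decodeTag (f (proj₁ t)))
    parent-later zero    _ x≢0 _   _   = contradiction refl x≢0
    parent-later (suc x) t _   w≢0 p≢0 with J (qW (suc x)) | J (qP (suc x))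
    ... | zero  | _     = contradiction refl w≢0
    ... | suc _ | zero  = contradiction refl p≢0
    ... | suc _ | suc _ = refl

    lineHeight-live : ∀ x → W x ≢ 0 → lineHeight x ≡ W x
    lineHeight-live x w≢0 with J (qW x)
    ... | zero  = contradiction refl w≢0
    ... | suc _ = refl

    module _ (src : SourceFacts) where
      open SourceFacts src

      W-source≢0 : W zero ≢ 0
      W-source≢0 eq with () ← trans (sym W-source) eq

      wellFormedRoot : WellFormedRoot tree
      wellFormedRoot = record
        { left-root≢root  = λ eq → S-source (cong proj₁ eq)
        ; right-root≢root = λ eq → S-source (cong proj₁ eq)
        ; parent-root     = refl
        ; height-root     = trans (lineHeight-live zero W-source≢0) W-source
        }

      sourceLine-wellFormed : LineFacts zero → ∀ t → WellFormedAt tree (zero , t)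
      sourceLine-wellFormed line₀ = λ where
          (zero , 0F) → record
            { parent-left     = parent-firstLine (zero , 0F)
            ; parent-right    = parent-firstLine (zero , 1F)
            ; left≡right⇒loop = λ eq → contradiction (cong (proj₂ ∘ proj₂) eq) λ ()
            ; child-of-parent = inj₁ refl
            ; height-step     = inj₁ refl
            }
          (zero , 1F) → selfLoop⇒wellFormed tree refl refl refl
          (suc y , b) → record
            { parent-left     = refl
            ; parent-right    = parent-firstLine (suc y , b)
            ; left≡right⇒loop = λ eq → contradiction (sym (cong proj₁ eq)) S-source
            ; child-of-parent = inj₂ (inj₁ refl)
            ; height-step     = inj₂ (inj₁ refl)
            }
        where
          open LineFacts line₀
          parent-firstLine : ∀ t → parent (S zero , t) ≡ (zero , collapse t)
          parent-firstLine t = parent-first (S zero) t S-source (W∘S≢0 line₀ W-source≢0) P∘S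

      module _ {x : Fin M} (x≢0 : x ≢ zero) (line : LineFacts x) (w≢0 : W x ≢ 0) (y : Fin N) (b : Fin 2)
               (f∘g : f (g (encodeTag (y , b))) ≡ encodeTag (y , b)) (g∘f : g (f y) ≡ y) where
        open LineFacts line
        open ≡-Reasoning

        parent-child : ∀ c → parent (S x , g (encodeTag (y , b)) , c) ≡ (x , y , b)
        parent-child c = begin
          parent (S x , g (encodeTag (y , b)) , c)
            ≡⟨ parent-later (S x) _ (S≢zero src line) (W∘S≢0 line w≢0) (λ eq → x≢0 (trans (sym P∘S) eq)) ⟩
          (P (S x) , decodeTag (f (g (encodeTag (y , b)))))
            ≡⟨ cong₂ _,_ P∘S (cong decodeTag f∘g) ⟩
          (x , decodeTag (encodeTag (y , b)))
            ≡⟨ cong (x ,_) (decodeTag∘encodeTag (y , b)) ⟩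
          (x , y , b) ∎

        child-of-parent-live : (x , y , b) ≡ left (parent (x , y , b)) ⊎ (x , y , b) ≡ right (parent (x , y , b))
        child-of-parent-live with P x ≟ zero
        ... | yes p≡0 rewrite parent-first x (y , b) x≢0 w≢0 p≡0 = child (y , b)
          where
            S₀≡x : S zero ≡ x
            S₀≡x = trans (cong S (sym p≡0)) (S∘P x≢0)
            child : ∀ t → (x , t) ≡ left (zero , collapse t) ⊎ (x , t) ≡ right (zero , collapse t)
            child (zero  , 0F) = inj₁ (cong (_, zero , 0F) (sym S₀≡x))
            child (zero  , 1F) = inj₂ (cong (_, zero , 1F) (sym S₀≡x))
            child (suc y , b)  = inj₂ (cong (_, suc y , b) (sym S₀≡x))
        ... | no p≢0 rewrite parent-later x (y , b) x≢0 w≢0 p≢0 = child b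
          where
            live-P : W (P x) ≢ 0
            live-P = W∘P≢0 line x≢0 w≢0
            back : ∀ c → (S (P x) , g (encodeTag (decodeTag (f y))) , c) ≡ (x , y , c)
            back c = cong₂ (λ u v → (u , v , c)) (S∘P x≢0) (trans (cong g (encodeTag∘decodeTag (f y))) g∘f)
            child : ∀ c → (x , y , c) ≡ left (P x , decodeTag (f y)) ⊎ (x , y , c) ≡ right (P x , decodeTag (f y))
            child 0F = inj₁ (sym (trans (left-live (P x) _ p≢0 live-P) (back 0F)))
            child 1F = inj₂ (sym (trans (right-live (P x) _ p≢0 live-P) (back 1F)))

        height-step-live : height (x , y , b) ≡ ℕ.suc (height (parent (x , y , b)))
        height-step-live = begin
          lineHeight x                                    ≡⟨ lineHeight-live x w≢0 ⟩
          W x                                             ≡⟨ W≡suc-W∘P line x≢0 w≢0 ⟩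
          ℕ.suc (W (P x))                                 ≡⟨ cong ℕ.suc (lineHeight-live (P x) (W∘P≢0 line x≢0 w≢0)) ⟨
          ℕ.suc (lineHeight (P x))                        ≡⟨ cong (ℕ.suc ∘ lineHeight) (parent-live-line x (y , b) x≢0 w≢0) ⟨
          ℕ.suc (lineHeight (proj₁ (parent (x , y , b)))) ∎

        liveLine-wellFormed : WellFormedAt tree (x , y , b)
        liveLine-wellFormed = record
          { parent-left     = trans (cong parent (left-live x (y , b) x≢0 w≢0)) (parent-child 0F)
          ; parent-right    = trans (cong parent (right-live x (y , b) x≢0 w≢0)) (parent-child 1F)
          ; left≡right⇒loop = λ eq → contradiction
              (cong (proj₂ ∘ proj₂) (trans (sym (left-live x (y , b) x≢0 w≢0)) (trans eq (right-live x (y , b) x≢0 w≢0))))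
              λ ()
          ; child-of-parent = inj₂ child-of-parent-live
          ; height-step     = inj₂ (inj₂ height-step-live)
          }

      wellFormedAt : ∀ x y b → LineFacts zero → LineFacts x →
                     f (g (encodeTag (y , b))) ≡ encodeTag (y , b) → g (f y) ≡ y → WellFormedAt tree (x , y , b)
      wellFormedAt zero    y b line₀ _    _   _   = sourceLine-wellFormed line₀ (y , b)
      wellFormedAt (suc x) y b _     line f∘g g∘f with W (suc x) ℕ.≟ 0
      ... | yes w≡0 = let p , l , r = dead-selfLoop (suc x) (y , b) (λ ()) w≡0 in selfLoop⇒wellFormed tree p l r
      ... | no  w≢0 = liveLine-wellFormed (λ ()) line w≢0 y b f∘g g∘f

module Reduction (n m : ℕ) where
  open Construction n m

  Source Target : SearchProblem
  Source = BLC∩EOML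
  Target = Binary-Empty-Child-w-Height

  -- suc k reduces to M * (2 * N), so the target vertices are exactly the encoded points.
  k : ℕ
  k = ℕ.pred (M * (2 * N))

  Q : Set
  Q = Query Source (n , m)

  A : Q → Set
  A = Ans Source (n , m)

  encodePoint : Point → Fin (ℕ.suc k)
  encodePoint (x , t) = combine x (encodeTag t)

  decodePoint : Fin (ℕ.suc k) → Point
  decodePoint u = map₂ decodeTag (remQuot (2 * N) u)

  decode∘encode : ∀ p → decodePoint (encodePoint p) ≡ p
  decode∘encode (x , t) =
    trans (cong (map₂ decodeTag) (remQuot-combine x (encodeTag t))) (cong (x ,_) (decodeTag∘encodeTag t))

  encode∘decode : ∀ u → encodePoint (decodePoint u) ≡ u
  encode∘decode u =
    trans (cong (combine (proj₁ xz)) (encodeTag∘decodeTag (proj₂ xz))) (combine-remQuot {M} (2 * N) u)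
    where
      xz : Fin M × Fin (2 * N)
      xz = remQuot {M} (2 * N) u

  position : BECQuery (ℕ.suc k) → Fin (ℕ.suc k)
  position (qF u) = u
  position (qL u) = u
  position (qR u) = u
  position (qH u) = u

  readLocal : Point → DT Q A Local
  readLocal (x , y , b) = do
    w  ← ask (inj₂ (qW x))
    p  ← ask (inj₂ (qP x))
    s  ← ask (inj₂ (qS x))
    fy ← ask (inj₁ (qf y))
    gt ← ask (inj₁ (qg (encodeTag (y , b))))
    leaf (local w p s fy gt)

  answer : BECQuery (ℕ.suc k) → Point → Local → Fin (ℕ.suc k)
  answer (qF _) p ℓ = encodePoint (parentAt p ℓ)
  answer (qL _) p ℓ = encodePoint (leftAt p ℓ)
  answer (qR _) p ℓ = encodePoint (rightAt p ℓ)
  answer (qH _) p ℓ = inject≤ (level (Local.weight ℓ)) (m≤m*n M (2 * N))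

  instanceTree : BECQuery (ℕ.suc k) → DT Q A (Fin (ℕ.suc k))
  instanceTree q = readLocal p >>= λ ℓ → leaf (answer q p ℓ)
    where
      p : Point
      p = decodePoint (position q)

  readMetered : Fin M → DT Q A (MeteredView M)
  readMetered x = do
    p₁   ← ask (inj₂ (qP zero))
    s₁   ← ask (inj₂ (qS zero))
    w₁   ← ask (inj₂ (qW zero))
    pₓ   ← ask (inj₂ (qP x))
    sₓ   ← ask (inj₂ (qS x))
    p∘sₓ ← ask (inj₂ (qP sₓ))
    s∘pₓ ← ask (inj₂ (qS pₓ))
    wₓ   ← ask (inj₂ (qW x))
    w∘sₓ ← ask (inj₂ (qW sₓ))
    w∘pₓ ← ask (inj₂ (qW pₓ))
    leaf (view p₁ s₁ w₁ pₓ sₓ p∘sₓ s∘pₓ wₓ w∘sₓ w∘pₓ)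

  -- g (f y) is never queried: when f (g z) ≡ z, no-violation below refutes g (f y) ≡ y.
  solutionTree : Fin (ℕ.suc k) → DT Q A (Sol Source (n , m))
  solutionTree u = do
    v₁  ← readMetered zero
    vₓ  ← readMetered x
    gz  ← ask (inj₁ (qg z))
    fgz ← ask (inj₁ (qf gz))
    leaf (if does (meteredSolution? zero v₁) then inj₂ zero
          else if does (meteredSolution? x vₓ) then inj₂ x
          else if does (fgz ≟ z) then inj₁ (inj₂ y)
          else inj₁ (inj₁ z))
    where
      x : Fin M
      x = proj₁ (decodePoint u)
      y : Fin N
      y = proj₁ (proj₂ (decodePoint u))
      z : Fin (2 * N)
      z = encodeTag (proj₂ (decodePoint u))

  readLocal-depth : ∀ p → DepthLE 5 (readLocal p)
  readLocal-depth p = node≤ λ _ → node≤ λ _ → node≤ λ _ → node≤ λ _ → node≤ λ _ → leaf≤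

  readMetered-depth : ∀ x → DepthLE 10 (readMetered x)
  readMetered-depth x =
    node≤ λ _ → node≤ λ _ → node≤ λ _ → node≤ λ _ → node≤ λ _ →
    node≤ λ _ → node≤ λ _ → node≤ λ _ → node≤ λ _ → node≤ λ _ → leaf≤

  instanceTree-depth : ∀ q → DepthLE 22 (instanceTree q)
  instanceTree-depth q = >>=-depth (readLocal-depth (decodePoint (position q))) λ _ → leaf≤

  solutionTree-depth : ∀ u → DepthLE 22 (solutionTree u)
  solutionTree-depth u =
    >>=-depth (readMetered-depth zero) λ _ →
    >>=-depth (readMetered-depth (proj₁ (decodePoint u))) λ _ →
    node≤ λ _ → node≤ λ _ → leaf≤

  module _ (I : (q : Q) → A q) where
    J : (q : EOMLQuery M) → EOMLAns M q
    J q = I (inj₂ q)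

    f : Fin N → Fin (2 * N)
    f y = I (inj₁ (qf y))

    g : Fin (2 * N) → Fin N
    g z = I (inj₁ (qg z))

    open MeteredLine J using (solution?; ¬solution⇒sourceFacts; ¬solution⇒lineFacts)

    I* : BECQuery (ℕ.suc k) → Fin (ℕ.suc k)
    I* q = eval (instanceTree q) I

    embedding : Embedding (tree J f g) (oracleTree I*)
    embedding = record
      { embed           = encodePoint
      ; embed-injective = λ {p} {q} eq →
          trans (sym (decode∘encode p)) (trans (cong decodePoint eq) (decode∘encode q))
      ; embed-root      = refl
      ; embed-parent    = λ p → cong (λ q → encodePoint (parentAt q (localAt J f g q))) (decode∘encode p)
      ; embed-left      = λ p → cong (λ q → encodePoint (leftAt q (localAt J f g q))) (decode∘encode p)
      ; embed-right     = λ p → cong (λ q → encodePoint (rightAt q (localAt J f g q))) (decode∘encode p)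
      ; embed-height    = λ p → trans (cong ℕ.suc (toℕ-inject≤ _ _))
                                      (cong (lineHeight J f g ∘ proj₁) (decode∘encode p))
      }

    module _ (u : Fin (ℕ.suc k)) where
      x : Fin M
      x = proj₁ (decodePoint u)
      y : Fin N
      y = proj₁ (proj₂ (decodePoint u))
      b : Fin 2
      b = proj₂ (proj₂ (decodePoint u))
      z : Fin (2 * N)
      z = encodeTag (y , b)

      no-violation : ¬ EOMLSol J zero → ¬ EOMLSol J x → f (g z) ≡ z → g (f y) ≡ y → ¬ BECSol I* u
      no-violation ¬sol₁ ¬solₓ f∘g g∘f =
        subst (¬_ ∘ Violation (oracleTree I*)) (encode∘decode u)
          (wellFormed⇒¬violation (oracleTree I*)
            (embed-wellFormedRoot embedding (wellFormedRoot J f g src))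
            (embed-wellFormedAt embedding
              (wellFormedAt J f g src x y b (¬solution⇒lineFacts ¬sol₁) (¬solution⇒lineFacts ¬solₓ) f∘g g∘f)))
        where
          src : MeteredLine.SourceFacts J
          src = ¬solution⇒sourceFacts ¬sol₁

      solutionTree-correct : BECSol I* u → IsSol Source (n , m) I (eval (solutionTree u) I)
      solutionTree-correct violation =
        if-does Ok (solution? zero) id λ ¬sol₁ →
        if-does Ok (solution? x) id λ ¬solₓ →
        if-does Ok (f (g z) ≟ z) (λ f∘g g∘f → no-violation ¬sol₁ ¬solₓ f∘g g∘f violation) id
        where
          Ok : Sol Source (n , m) → Set
          Ok = IsSol Source (n , m) I

  reduction : DTReductionAt Source Target (n , m)
  reduction = record
    { tgt       = k
    ; depth     = 22
    ; instTree  = instanceTree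
    ; solTree   = solutionTree
    ; instDepth = instanceTree-depth
    ; solDepth  = solutionTree-depth
    ; correct   = solutionTree-correct
    }

  ⌈log₂targetSize⌉≤2+2⌈log₂sourceSize⌉ :
    let L = ⌈log₂ size Source (n , m) ⌉ in ⌈log₂ size Target k ⌉ ≤ 2 + (L + L)
  ⌈log₂targetSize⌉≤2+2⌈log₂sourceSize⌉ = begin
    ⌈log₂ (4 * (M * (2 * N))) ⌉         ≤⟨ ⌈log₂m*n⌉≤⌈log₂m⌉+⌈log₂n⌉ 4 (M * (2 * N)) ⟩
    2 + ⌈log₂ (M * (2 * N)) ⌉           ≤⟨ +-monoʳ-≤ 2 (⌈log₂m*n⌉≤⌈log₂m⌉+⌈log₂n⌉ M (2 * N)) ⟩
    2 + (⌈log₂ M ⌉ + ⌈log₂ (2 * N) ⌉)   ≤⟨ +-monoʳ-≤ 2 (+-mono-≤ (⌈log₂⌉-mono-≤ M≤S) (⌈log₂⌉-mono-≤ 2N≤S)) ⟩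
    2 + (⌈log₂ S ⌉ + ⌈log₂ S ⌉)         ∎
    where
      open ≤-Reasoning
      S : ℕ
      S = 3 * N + 3 * M
      M≤S : M ≤ S
      M≤S = ≤-trans (m≤n*m M 3) (m≤n+m (3 * M) (3 * N))
      2N≤S : 2 * N ≤ S
      2N≤S = ≤-trans (*-monoˡ-≤ N {2} {3} (s≤s (s≤s z≤n))) (m≤m+n (3 * N) (3 * M))

2+[L+L]+22≤24*L^1+24 : ∀ L → 2 + (L + L) + 22 ≤ 24 * L ^ 1 + 24
2+[L+L]+22≤24*L^1+24 L = begin
  2 + (L + L) + 22   ≡⟨ trans (cong (_+ 22) (+-comm 2 (L + L))) (+-assoc (L + L) 2 22) ⟩
  L + L + 24         ≡⟨ cong (λ l → L + l + 24) (+-identityʳ L) ⟨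
  2 * L + 24         ≤⟨ +-monoˡ-≤ 24 (*-monoˡ-≤ L {2} {24} (s≤s (s≤s z≤n))) ⟩
  24 * L + 24        ≡⟨ cong (λ l → 24 * l + 24) (^-identityʳ L) ⟨
  24 * L ^ 1 + 24    ∎
  where open ≤-Reasoning

corollary5p8 : BLC∩EOML ≤dt Binary-Empty-Child-w-Height
corollary5p8 = (λ { (n , m) → Reduction.reduction n m }) , 24 , 1 , λ { (n , m) →
  ≤-trans (+-monoˡ-≤ 22 (Reduction.⌈log₂targetSize⌉≤2+2⌈log₂sourceSize⌉ n m))
          (2+[L+L]+22≤24*L^1+24 ⌈log₂ size BLC∩EOML (n , m) ⌉) }
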